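{- Let $p$ be a Miller tree and $S\in[\omega]^\omega$. For the game $\mathcal{G}(p,S)$: (1) Player I has a winning strategy if and only if there is a Miller tree $q\le p$ with $[q]_{split}\subseteq[S]^\omega$. (2) Player II has a winning strategy if and only if there is $H:Split(p)\to\omega$ such that for every $f\in[p]$ the set $\{f\upharpoonright n\in Split(p): f(n)\in S\}$ is almost contained in $\{f\upharpoonright n\in Split(p): f(n)<H(f\upharpoonright n)\}$; in that case in particular $[p]_{split}\cap Hit(S)\in\mathcal{K}(p)$.
   Context: A Miller tree is a nonempty tree $p\subseteq\omega^{<\omega}$ in which every node has an extension with infinitely many immediate successors; all Miller trees are assumed to consist of strictly increasing sequences. $q\le p$ means $q\subseteq p$ and $q$ is a Miller tree. $Split(p)$ is the set of nodes with infinitely many immediate successors, $[p]$ the set of branches $f\in\omega^\omega$ of $p$. For $f\in[p]$, $Sp(p,f)=\{f(n): f\upharpoonright n\in Split(p)\}$, $[p]_{split}=\{Sp(p,f):f\in[p]\}$. For $G:Split(p)\to\omega$, $Catch_\exists(G)=\{Sp(p,f): f\in[p],\ \exists^\infty n\,(f\upharpoonright n\in Split(p)\wedge f(n)<G(f\upharpoonright n))\}$, and $\mathcal{K}(p)$ is the family of $A\subseteq[p]_{split}$ with $A\subseteq Catch_\exists(G)$ for some $G$. $Hit(S)$ is the set of subsets of $\omega$ having infinite intersection with $S$. The game $\mathcal{G}(p,S)$: Player I plays $s_0$, II plays $r_0$, I plays $s_1$, II plays $r_1$, etc., where each $s_i\in Split(p)$, each $r_i\in\omega$, $s_{i+1}$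 extends $s_i$, and $s_{i+1}(|s_i|)\in S$ with $s_{i+1}(|s_i|)>r_i$. Player I wins if she can continue playing for infinitely many rounds (otherwise II wins). -}

module Defs where

open import Level using (0ℓ) renaming (suc to lsuc)
open import Data.Nat using (ℕ; zero; suc; _<_; _≤_)
open import Data.List using (List; []; _∷_; _++_; _∷ʳ_; map; length; upTo)
open import Data.List.Membership.Propositional using (_∈_)
open import Data.Product using (Σ; ∃; ∃-syntax; _×_; _,_)
open import Data.Sum using (_⊎_)
open import Data.Unit using (⊤)
open import Relation.Nullary using (¬_)
open import Relation.Binary.PropositionalEquality using (_≡_)

Seq : Set
Seq = List ℕ

SubsetOfω : Set₁
SubsetOfω = ℕ → Set

TreePred : Set₁
TreePred = Seq → Set

Family : Set₁
Family = SubsetOfω → Set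

-- A ⊆ ω is infinite (unbounded); also used for ∃^∞.
Infinite : SubsetOfω → Set
Infinite A = ∀ k → ∃[ m ] (k ≤ m × A m)

_⊆ω_ : SubsetOfω → SubsetOfω → Set
A ⊆ω B = ∀ m → A m → B m

_≐_ : SubsetOfω → SubsetOfω → Set
A ≐ B = (A ⊆ω B) × (B ⊆ω A)

InfSubsetOf : SubsetOfω → SubsetOfω → Set
InfSubsetOf S X = (X ⊆ω S) × Infinite X

Hit : SubsetOfω → SubsetOfω → Set
Hit S X = Infinite (λ m → X m × S m)

StrictlyIncreasing : Seq → Set
StrictlyIncreasing [] = ⊤
StrictlyIncreasing (x ∷ []) = ⊤
StrictlyIncreasing (x ∷ y ∷ l) = x < y × StrictlyIncreasing (y ∷ l)

_⊑_ : Seq → Seq → Set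
s ⊑ t = ∃[ u ] (t ≡ s ++ u)

_↾_ : (ℕ → ℕ) → ℕ → Seq
f ↾ n = map f (upTo n)

IsTree : TreePred → Set
IsTree p = p [] × (∀ s t → p (s ++ t) → p s)

Split : TreePred → Seq → Set
Split p s = p s × Infinite (λ k → p (s ∷ʳ k))

MillerTree : TreePred → Set
MillerTree p =
  IsTree p
  × (∀ s → p s → StrictlyIncreasing s)
  × (∀ s → p s → ∃[ t ] (s ⊑ t × Split p t))

_≤M_ : TreePred → TreePred → Set
q ≤M p = MillerTree q × (∀ s → q s → p s)

Branch : TreePred → (ℕ → ℕ) → Set
Branch p f = ∀ n → p (f ↾ n)

Sp : TreePred → (ℕ → ℕ) → SubsetOfω
Sp p f m = ∃[ n ] (Split p (f ↾ n) × f n ≡ m)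

InSplitBranches : TreePred → SubsetOfω → Set
InSplitBranches p X = ∃[ f ] (Branch p f × X ≐ Sp p f)

SplitBranchesIn : TreePred → SubsetOfω → Set₁
SplitBranchesIn q S = ∀ X → InSplitBranches q X → InfSubsetOf S X

-- Catch_∃(G) for G : Split(p) → ω (given as a function on all nodes;
-- only its values on Split(p) matter)
Catch∃ : TreePred → (Seq → ℕ) → SubsetOfω → Set
Catch∃ p G X = ∃[ f ] (Branch p f × X ≐ Sp p f
  × Infinite (λ n → Split p (f ↾ n) × f n < G (f ↾ n)))

InK : TreePred → Family → Set₁
InK p A = (∀ X → A X → InSplitBranches p X)
  × ∃[ G ] (∀ X → A X → Catch∃ p G X)

SplitHit : TreePred → SubsetOfω → Family
SplitHit p S X = InSplitBranches p X × Hit S X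

-- Legal move of player I in 𝒢(p,S): after position s_i and II's answer r_i,
-- the move s' must be a splitting node extending s_i properly with
-- s'(|s_i|) ∈ S and s'(|s_i|) > r_i.
LegalNext : TreePred → SubsetOfω → Seq → ℕ → Seq → Set
LegalNext p S s r s' =
  Split p s' × ∃[ k ] ∃[ u ] (s' ≡ s ++ (k ∷ u) × S k × r < k)

-- Strategy for I: maps the list of II's moves so far ⟨r_0,…,r_{i-1}⟩ to s_i.
-- It is winning iff it always produces a legal move (so I can play forever).
WinningStrategyI : TreePred → SubsetOfω → (List ℕ → Seq) → Set
WinningStrategyI p S σ =
  Split p (σ [])
  × (∀ rs r → LegalNext p S (σ rs) r (σ (rs ∷ʳ r)))

PlayerIWins : TreePred → SubsetOfω → Set
PlayerIWins p S = ∃[ σ ] WinningStrategyI p S σ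

-- Strategy for II: maps I's moves ⟨s_0,…,s_i⟩ to r_i.  It is winning iff
-- there is no infinite play of I that is legal against it.
InfinitePlayAgainst : TreePred → SubsetOfω → (List Seq → ℕ) → (ℕ → Seq) → Set
InfinitePlayAgainst p S τ ss =
  Split p (ss 0)
  × (∀ i → LegalNext p S (ss i) (τ (map ss (upTo (suc i)))) (ss (suc i)))

WinningStrategyII : TreePred → SubsetOfω → (List Seq → ℕ) → Set
WinningStrategyII p S τ = ¬ (∃[ ss ] InfinitePlayAgainst p S τ ss)

PlayerIIWins : TreePred → SubsetOfω → Set
PlayerIIWins p S = ∃[ τ ] WinningStrategyII p S τ

_⊆*_ : TreePred → TreePred → Set
A ⊆* B = ∃[ L ] (∀ s → A s → B s ⊎ s ∈ L)

SplitInS : TreePred → SubsetOfω → (ℕ → ℕ) → TreePred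
SplitInS p S f s = ∃[ n ] (s ≡ f ↾ n × Split p s × S (f n))

SplitBelowH : TreePred → (Seq → ℕ) → (ℕ → ℕ) → TreePred
SplitBelowH p H f s = ∃[ n ] (s ≡ f ↾ n × Split p s × f n < H s)

-- (1) A winning strategy σ for I unfolds into a Miller tree: at each position let II answer 0,
-- then each value I has just played; I's replies then form an increasing sequence of values in S,
-- so the positions reached spread out into infinitely many successors.  The initial segments of
-- these positions form q ≤ p whose only branching nodes are positions, so q splits only into
-- values in S.  Conversely, with such a q, I stays in q: above II's number r she steps to a
-- successor k > r of her current splitting node and then on to a splitting node of q; k ∈ S
-- because it belongs to the split set of any branch of q through it.
-- (2) If II wins with τ, let H(s) exceed τ on every list of at most |s| + 1 prefixes of s.  A
-- branch f with infinitely many splitting levels n where f(n) ∈ S but f(n) ≥ H(f↾n) yields a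
-- play f↾n₀, f↾n₁, … legal against τ, which is impossible.  Conversely II answers H of the
-- current position: the limit branch of an infinite play would enter S at arbitrarily late
-- splitting levels above the answers, i.e. above H.  Such an H catches every split set hitting S.

module Submission where

open import Defs
open import Axiom.ExcludedMiddle using (ExcludedMiddle)
open import Level using (0ℓ; lift; lower) renaming (suc to lsuc)
open import Function.Base using (_∘_)
open import Function.Bundles using (_⇔_; mk⇔)
open import Data.Nat
open import Data.Nat.Properties
open import Data.Maybe using (just; maybe′)
open import Data.List using (List; []; _∷_; _++_; _∷ʳ_; [_]; map; length; upTo; applyUpTo; foldl; inits; last)
open import Data.List.Properties
  using (++-identityʳ; ++-assoc; length-++; length-++-≤ˡ; length-map; length-upTo; map-++; map-upTo;
         upTo-∷ʳ; applyUpTo-∷ʳ; ∷ʳ-++; ∷ʳ-injective; foldl-∷ʳ)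
open import Data.List.Extrema.Nat using (max; xs≤max)
open import Data.List.Membership.Propositional using (_∈_)
open import Data.List.Membership.Propositional.Properties using (∈-map⁺; ∈-applyUpTo⁺)
open import Data.List.Relation.Unary.All as All using (All; []; _∷_)
open import Data.List.Relation.Unary.All.Properties using (applyUpTo⁺₁)
open import Data.List.Relation.Unary.Any using (here; there)
open import Data.Product using (Σ; Σ-syntax; ∃-syntax; _×_; _,_; proj₁; proj₂)
open import Data.Sum using (_⊎_; inj₁; inj₂)
open import Data.Empty using (⊥-elim)
open import Relation.Nullary using (¬_; Dec; yes; no)
open import Relation.Nullary.Decidable using (map′)
open import Relation.Binary.Definitions using (tri<; tri≈; tri>)
open import Relation.Binary.PropositionalEquality
  using (_≡_; _≢_; refl; sym; trans; cong; cong₂; subst; subst₂; module ≡-Reasoning)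

chain-mono : ∀ {A : Set} (R : A → A → Set) → (∀ {a} → R a a) → (∀ {a b c} → R a b → R b c → R a c)
  → (y : ℕ → A) → (∀ i → R (y i) (y (suc i))) → ∀ {i j} → i ≤ j → R (y i) (y j)
chain-mono R refl′ trans′ y step {j = zero} z≤n = refl′
chain-mono R refl′ trans′ y step {i} {suc j} i≤1+j with m≤n⇒m<n∨m≡n i≤1+j
... | inj₁ i<1+j = trans′ (chain-mono R refl′ trans′ y step (≤-pred i<1+j)) (step j)
... | inj₂ refl = refl′

Increasing : (ℕ → ℕ) → Set
Increasing g = ∀ i → g i < g (suc i)

module _ {g : ℕ → ℕ} (g↑ : Increasing g) where

  increasing-mono : ∀ {i j} → i ≤ j → g i ≤ g j
  increasing-mono = chain-mono _≤_ ≤-refl ≤-trans g (<⇒≤ ∘ g↑)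

  increasing-strict : ∀ {i j} → i < j → g i < g j
  increasing-strict {i} i<j = <-≤-trans (g↑ i) (increasing-mono i<j)

  increasing-injective : ∀ {i j} → g i ≡ g j → i ≡ j
  increasing-injective {i} {j} gi≡gj with <-cmp i j
  ... | tri< i<j _ _ = ⊥-elim (<-irrefl gi≡gj (increasing-strict i<j))
  ... | tri≈ _ i≡j _ = i≡j
  ... | tri> _ _ j<i = ⊥-elim (<-irrefl (sym gi≡gj) (increasing-strict j<i))

  increasing-≥ : ∀ i → i ≤ g i
  increasing-≥ zero = z≤n
  increasing-≥ (suc i) = <-≤-trans (s≤s (increasing-≥ i)) (g↑ i)

module Enumeration {P : ℕ → Set} (P-infinite : Infinite P) where

  nth : ℕ → ℕ
  nth zero = proj₁ (P-infinite 0)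
  nth (suc i) = proj₁ (P-infinite (suc (nth i)))

  nth↑ : Increasing nth
  nth↑ i = proj₁ (proj₂ (P-infinite (suc (nth i))))

  nth-P : ∀ i → P (nth i)
  nth-P zero = proj₂ (proj₂ (P-infinite 0))
  nth-P (suc i) = proj₂ (proj₂ (P-infinite (suc (nth i))))

maxUpTo : (ℕ → ℕ) → ℕ → ℕ
maxUpTo g k = max 0 (applyUpTo g (suc k))

≤-maxUpTo : ∀ g {a k} → a ≤ k → g a ≤ maxUpTo g k
≤-maxUpTo g {k = k} a≤k = All.lookup (xs≤max 0 (applyUpTo g (suc k))) (∈-applyUpTo⁺ g (s≤s a≤k))

boundOn : {A : Set} → List A → (List A → ℕ) → ℕ → ℕ
boundOn xs t zero = t []
boundOn xs t (suc m) = t [] ⊔ max 0 (map (λ a → boundOn xs (t ∘ (a ∷_)) m) xs)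

≤-boundOn : ∀ {A : Set} (xs : List A) t {m c} → All (_∈ xs) c → length c ≤ m → t c ≤ boundOn xs t m
≤-boundOn xs t {zero} [] _ = ≤-refl
≤-boundOn xs t {suc m} [] _ = m≤m⊔n _ _
≤-boundOn xs t {suc m} (_∷_ {a} {c} a∈xs c⊆xs) (s≤s c≤m) = begin
  t (a ∷ c)                  ≤⟨ ≤-boundOn xs (t ∘ (a ∷_)) c⊆xs c≤m ⟩
  boundOn xs (t ∘ (a ∷_)) m  ≤⟨ All.lookup (xs≤max 0 bounds) (∈-map⁺ _ a∈xs) ⟩
  max 0 bounds               ≤⟨ m≤n⊔m (t []) _ ⟩
  t [] ⊔ max 0 bounds        ∎
  where
  open ≤-Reasoning
  bounds = map (λ a → boundOn xs (t ∘ (a ∷_)) m) xs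

-- Out-of-range entries read as 0; every use below carries a length bound.
infixl 10 _!_
_!_ : Seq → ℕ → ℕ
[] ! _ = 0
(a ∷ x) ! zero = a
(a ∷ x) ! suc i = x ! i

!-++ˡ : ∀ (x y : Seq) {i} → i < length x → (x ++ y) ! i ≡ x ! i
!-++ˡ (a ∷ x) y {zero} _ = refl
!-++ˡ (a ∷ x) y {suc i} (s≤s i<x) = !-++ˡ x y i<x

!-∷ʳ : ∀ (x : Seq) a → (x ∷ʳ a) ! length x ≡ a
!-∷ʳ [] a = refl
!-∷ʳ (b ∷ x) a = !-∷ʳ x a

length-∷ʳ : ∀ (x : Seq) a → length (x ∷ʳ a) ≡ suc (length x)
length-∷ʳ x a = trans (length-++ x) (+-comm (length x) 1)

<-length-∷ʳ : ∀ (x : Seq) a → length x < length (x ∷ʳ a)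
<-length-∷ʳ x a = ≤-reflexive (sym (length-∷ʳ x a))

⊑-refl : ∀ x → x ⊑ x
⊑-refl x = [] , sym (++-identityʳ x)

⊑-trans : ∀ {x y z} → x ⊑ y → y ⊑ z → x ⊑ z
⊑-trans {x} (u , refl) (v , refl) = u ++ v , ++-assoc x u v

⊑-++ : ∀ x u → x ⊑ (x ++ u)
⊑-++ x u = u , refl

⊑-length : ∀ {x y} → x ⊑ y → length x ≤ length y
⊑-length {x} (u , refl) = length-++-≤ˡ x

⊑-! : ∀ {x y i} → x ⊑ y → i < length x → x ! i ≡ y ! i
⊑-! {x} (u , refl) i<x = sym (!-++ˡ x u i<x)

⊑-∷ʳ-! : ∀ {x a y} → (x ∷ʳ a) ⊑ y → y ! length x ≡ a
⊑-∷ʳ-! {x} {a} h = trans (sym (⊑-! h (<-length-∷ʳ x a))) (!-∷ʳ x a)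

⊑-∷ʳ-length : ∀ {x a y} → (x ∷ʳ a) ⊑ y → length x < length y
⊑-∷ʳ-length {x} {a} h = <-≤-trans (<-length-∷ʳ x a) (⊑-length h)

⊑-∷ʳ-agree : ∀ {z w₁ w₂ x a b} → z ⊑ w₁ → z ⊑ w₂ → length x < length z
  → (x ∷ʳ a) ⊑ w₁ → (x ∷ʳ b) ⊑ w₂ → a ≡ b
⊑-∷ʳ-agree z⊑w₁ z⊑w₂ x<z h₁ h₂ =
  trans (sym (⊑-∷ʳ-! h₁)) (trans (sym (⊑-! z⊑w₁ x<z)) (trans (⊑-! z⊑w₂ x<z) (⊑-∷ʳ-! h₂)))

⊑-by-index : ∀ x y → length x ≤ length y → (∀ i → i < length x → x ! i ≡ y ! i) → x ⊑ y
⊑-by-index [] y _ _ = y , refl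
⊑-by-index (a ∷ x) (b ∷ y) (s≤s x≤y) agree
  with agree 0 z<s | ⊑-by-index x y x≤y (λ i → agree (suc i) ∘ s≤s)
... | refl | u , refl = u , refl

⊑-length-≡ : ∀ {x y} → x ⊑ y → length x ≡ length y → x ≡ y
⊑-length-≡ {[]} ([] , refl) _ = refl
⊑-length-≡ {a ∷ x} (u , refl) e = cong (a ∷_) (⊑-length-≡ (u , refl) (suc-injective e))

⊑-unique-length : ∀ {x y z} → x ⊑ z → y ⊑ z → length x ≡ length y → x ≡ y
⊑-unique-length {x} {y} x⊑z y⊑z e = ⊑-length-≡ (⊑-by-index x y (≤-reflexive e) agree) e
  where
  agree : ∀ i → i < length x → x ! i ≡ y ! i
  agree i i<x = trans (⊑-! x⊑z i<x) (sym (⊑-! y⊑z (subst (i <_) e i<x)))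

⊑⇒∈inits : ∀ {x y : Seq} → x ⊑ y → x ∈ inits y
⊑⇒∈inits {[]} _ = here refl
⊑⇒∈inits {a ∷ x} (u , refl) = there (∈-map⁺ (a ∷_) (⊑⇒∈inits {x} (u , refl)))

length-↾ : ∀ f n → length (f ↾ n) ≡ n
length-↾ f n = trans (length-map f (upTo n)) (length-upTo n)

applyUpTo-! : ∀ (f : ℕ → ℕ) {n i} → i < n → applyUpTo f n ! i ≡ f i
applyUpTo-! f {suc n} {zero} _ = refl
applyUpTo-! f {suc n} {suc i} (s≤s i<n) = applyUpTo-! (f ∘ suc) i<n

↾-! : ∀ f {n i} → i < n → (f ↾ n) ! i ≡ f i
↾-! f {n} {i} i<n = trans (cong (λ l → l ! i) (map-upTo f n)) (applyUpTo-! f i<n)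

↾-suc : ∀ f n → f ↾ suc n ≡ (f ↾ n) ∷ʳ f n
↾-suc f n = begin
  f ↾ suc n            ≡⟨ cong (map f) (sym (upTo-∷ʳ n)) ⟩
  map f (upTo n ∷ʳ n)  ≡⟨ map-++ f (upTo n) [ n ] ⟩
  (f ↾ n) ∷ʳ f n       ∎
  where open ≡-Reasoning

↾-mono : ∀ f {n m} → n ≤ m → (f ↾ n) ⊑ (f ↾ m)
↾-mono f = chain-mono _⊑_ (⊑-refl _) ⊑-trans (f ↾_) (λ n → [ f n ] , ↾-suc f n)

↾-step : ∀ f {n m} → n < m → ∃[ u ] (f ↾ m ≡ f ↾ n ++ (f n ∷ u))
↾-step f {n} n<m with ↾-mono f n<m
... | u , eq = u , trans eq (trans (cong (_++ u) (↾-suc f n)) (∷ʳ-++ (f ↾ n) (f n) u))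

↾-injectiveˡ : ∀ f {n m} → f ↾ n ≡ f ↾ m → n ≡ m
↾-injectiveˡ f {n} {m} e = trans (sym (length-↾ f n)) (trans (cong length e) (length-↾ f m))

↾-∷ʳ⁻¹ : ∀ f (s : Seq) {k} → f ↾ length (s ∷ʳ k) ≡ s ∷ʳ k → f ↾ length s ≡ s × f (length s) ≡ k
↾-∷ʳ⁻¹ f s {k} e = ∷ʳ-injective (f ↾ length s) s (begin
  (f ↾ length s) ∷ʳ f (length s)  ≡⟨ sym (↾-suc f (length s)) ⟩
  f ↾ suc (length s)              ≡⟨ cong (f ↾_) (sym (length-∷ʳ s k)) ⟩
  f ↾ length (s ∷ʳ k)             ≡⟨ e ⟩
  s ∷ʳ k                          ∎)
  where open ≡-Reasoning

applyUpTo-agree : ∀ f x → (∀ i → i < length x → f i ≡ x ! i) → applyUpTo f (length x) ≡ x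
applyUpTo-agree f [] _ = refl
applyUpTo-agree f (a ∷ x) agree =
  cong₂ _∷_ (agree 0 z<s) (applyUpTo-agree (f ∘ suc) x (λ i → agree (suc i) ∘ s≤s))

↾-agree : ∀ f x → (∀ i → i < length x → f i ≡ x ! i) → f ↾ length x ≡ x
↾-agree f x agree = trans (map-upTo f (length x)) (applyUpTo-agree f x agree)

applyUpTo-branchesOff : ∀ f c → applyUpTo f (length c) ≡ c
  ⊎ ∃[ i ] (i < length c × f i ≢ c ! i × (applyUpTo f i ∷ʳ c ! i) ⊑ c)
applyUpTo-branchesOff f [] = inj₁ refl
applyUpTo-branchesOff f (a ∷ c) with f 0 ≟ a
... | no f0≢a = inj₂ (0 , z<s , f0≢a , c , refl)
... | yes refl with applyUpTo-branchesOff (f ∘ suc) c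
...   | inj₁ e = inj₁ (cong (f 0 ∷_) e)
...   | inj₂ (i , i<c , ne , u , e) = inj₂ (suc i , s≤s i<c , ne , u , cong (f 0 ∷_) e)

↾-branchesOff : ∀ f c → f ↾ length c ≡ c ⊎ ∃[ i ] (i < length c × f i ≢ c ! i × ((f ↾ i) ∷ʳ c ! i) ⊑ c)
↾-branchesOff f c with applyUpTo-branchesOff f c
... | inj₁ e = inj₁ (trans (map-upTo f (length c)) e)
... | inj₂ (i , i<c , ne , h) =
  inj₂ (i , i<c , ne , subst (λ y → (y ∷ʳ c ! i) ⊑ c) (sym (map-upTo f i)) h)

StrictlyIncreasing-! : ∀ l → StrictlyIncreasing l → ∀ {i} → i < length l → l ! 0 + i ≤ l ! i
StrictlyIncreasing-! (x ∷ l) _ {zero} _ = ≤-reflexive (+-identityʳ x)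
StrictlyIncreasing-! (x ∷ y ∷ l) (x<y , y∷l↑) {suc i} (s≤s i<l) = begin
  x + suc i  ≡⟨ +-suc x i ⟩
  suc x + i  ≤⟨ +-monoˡ-≤ i x<y ⟩
  y + i      ≤⟨ StrictlyIncreasing-! (y ∷ l) y∷l↑ i<l ⟩
  (y ∷ l) ! i ∎
  where open ≤-Reasoning

increasingBranch-≥ : ∀ {p f} → (∀ s → p s → StrictlyIncreasing s) → Branch p f → ∀ n → n ≤ f n
increasingBranch-≥ {f = f} p↑ br n = begin
  n           ≤⟨ m≤n+m n _ ⟩
  l ! 0 + n   ≤⟨ StrictlyIncreasing-! l (p↑ l (br (suc n))) (≤-reflexive (sym (length-↾ f (suc n)))) ⟩
  l ! n       ≡⟨ ↾-! f ≤-refl ⟩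
  f n         ∎
  where
  open ≤-Reasoning
  l = f ↾ suc n

IsTree-⊑ : ∀ {p} → IsTree p → ∀ {x y} → x ⊑ y → p y → p x
IsTree-⊑ (_ , closed) {x} (u , refl) py = closed x u py

Split-mono : ∀ {p q} → (∀ s → q s → p s) → ∀ {s} → Split q s → Split p s
Split-mono q⊆p (qs , succ) = q⊆p _ qs , λ b → let (k , b≤k , qsk) = succ b in k , b≤k , q⊆p _ qsk

module Limit (y : ℕ → Seq) (step : ∀ i → y i ⊑ y (suc i)) (grows : Increasing (length ∘ y)) where

  lim : ℕ → ℕ
  lim n = y (suc n) ! n

  lim-! : ∀ i {n} → n < length (y i) → lim n ≡ y i ! n
  lim-! i {n} n<y with ≤-total i (suc n)
  ... | inj₁ i≤1+n = sym (⊑-! (chain-mono _⊑_ (⊑-refl _) ⊑-trans y step i≤1+n) n<y)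
  ... | inj₂ 1+n≤i = ⊑-! (chain-mono _⊑_ (⊑-refl _) ⊑-trans y step 1+n≤i) (increasing-≥ grows (suc n))

  lim-↾ : ∀ i → lim ↾ length (y i) ≡ y i
  lim-↾ i = ↾-agree lim (y i) (λ n → lim-! i)

  lim-branch : ∀ {p} → IsTree p → (∀ i → p (y i)) → Branch p lim
  lim-branch T py n = IsTree-⊑ T (subst ((lim ↾ n) ⊑_) (lim-↾ n) (↾-mono lim (increasing-≥ grows n))) (py n)

module LegalMoves (p : TreePred) (S : SubsetOfω) {s : Seq} {r : ℕ} {s′ : Seq} where

  legal-value : LegalNext p S s r s′ → ℕ
  legal-value (_ , k , _) = k

  legal-split : LegalNext p S s r s′ → Split p s′
  legal-split (split , _) = split

  legal-∈S : (l : LegalNext p S s r s′) → S (legal-value l)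
  legal-∈S (_ , _ , _ , _ , Sk , _) = Sk

  legal-> : (l : LegalNext p S s r s′) → r < legal-value l
  legal-> (_ , _ , _ , _ , _ , r<k) = r<k

  legal-∷ʳ-⊑ : (l : LegalNext p S s r s′) → (s ∷ʳ legal-value l) ⊑ s′
  legal-∷ʳ-⊑ (_ , k , u , refl , _) = u , sym (∷ʳ-++ s k u)

  legal-⊑ : LegalNext p S s r s′ → s ⊑ s′
  legal-⊑ l = ⊑-trans (⊑-++ s _) (legal-∷ʳ-⊑ l)

  legal-grows : LegalNext p S s r s′ → length s < length s′
  legal-grows l = <-≤-trans (<-length-∷ʳ s _) (⊑-length (legal-∷ʳ-⊑ l))

-- Player I

module _ {q : TreePred} (Mq : MillerTree q) where

  private
    splitAbove : ∀ s → q s → ∃[ t ] (s ⊑ t × Split q t)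
    splitAbove = proj₂ (proj₂ Mq)

  properExtension : ∀ {z} → q z → ∃[ z′ ] (q z′ × z ⊑ z′ × length z < length z′)
  properExtension {z} qz with splitAbove z qz
  ... | t , z⊑t , (_ , succ) with succ 0
  ...   | k , _ , qtk = t ∷ʳ k , qtk , ⊑-trans z⊑t (⊑-++ t [ k ]) , ≤-<-trans (⊑-length z⊑t) (<-length-∷ʳ t k)

  branchThrough : ∀ {x} → q x → ∃[ f ] (Branch q f × f ↾ length x ≡ x)
  branchThrough {x} qx = lim , lim-branch (proj₁ Mq) (λ i → proj₂ (y i)) , lim-↾ 0
    where
    y : ℕ → Σ Seq q
    y zero = x , qx
    y (suc i) = let (z′ , qz′ , _) = properExtension (proj₂ (y i)) in z′ , qz′
    step : ∀ i → proj₁ (y i) ⊑ proj₁ (y (suc i))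
    step i = let (_ , _ , z⊑z′ , _) = properExtension (proj₂ (y i)) in z⊑z′
    grows : Increasing (length ∘ proj₁ ∘ y)
    grows i = let (_ , _ , _ , z<z′) = properExtension (proj₂ (y i)) in z<z′
    open Limit (proj₁ ∘ y) step grows

  splitSuccessor∈S : ∀ {S s k} → SplitBranchesIn q S → Split q s → q (s ∷ʳ k) → S k
  splitSuccessor∈S {S} {s} {k} qS split qsk with branchThrough qsk
  ... | f , br , f↾≡ with ↾-∷ʳ⁻¹ f s f↾≡
  ...   | f↾s≡s , fs≡k = proj₁ (qS (Sp q f) (f , br , (λ _ x → x) , (λ _ x → x))) k
                           (length s , subst (Split q) (sym f↾s≡s) split , fs≡k)

splitSubtree⇒IWins : ∀ {p S} → ∃[ q ] (q ≤M p × SplitBranchesIn q S) → PlayerIWins p S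
splitSubtree⇒IWins {p} {S} (q , (Mq@((q[] , _) , _ , splitAbove) , q⊆p) , qS) =
  σ , Split-mono q⊆p (proj₂ start) , legal
  where
  Position : Set
  Position = Σ Seq (Split q)

  respond : (pos : Position) (r : ℕ) → Σ[ pos′ ∈ Position ] LegalNext p S (proj₁ pos) r (proj₁ pos′)
  respond (s , split@(_ , succ)) r with succ (suc r)
  ... | k , r<k , qsk with splitAbove _ qsk
  ...   | t , (u , refl) , splitT =
    (_ , splitT) , Split-mono q⊆p splitT , k , u , ∷ʳ-++ s k u , splitSuccessor∈S Mq qS split qsk , r<k

  start : Position
  start = let (t , _ , splitT) = splitAbove [] q[] in t , splitT

  play : List ℕ → Position
  play = foldl (λ pos r → proj₁ (respond pos r)) start

  σ : List ℕ → Seq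
  σ = proj₁ ∘ play

  legal : ∀ rs r → LegalNext p S (σ rs) r (σ (rs ∷ʳ r))
  legal rs r = subst (LegalNext p S (σ rs) r ∘ proj₁) (sym (foldl-∷ʳ _ start r rs)) (proj₂ (respond (play rs) r))

module StrategyTree {p : TreePred} {S : SubsetOfω} (σ : List ℕ → Seq)
                    (legal : ∀ rs r → LegalNext p S (σ rs) r (σ (rs ∷ʳ r))) where

  open LegalMoves p S

  value : List ℕ → ℕ → ℕ
  value rs r = legal-value (legal rs r)

  -- At position rs, II's answers 0, c₀, c₁, … make I play the values c₀ < c₁ < c₂ < … .
  answer : List ℕ → ℕ → ℕ
  answer rs zero = 0
  answer rs (suc j) = value rs (answer rs j)

  child : List ℕ → ℕ → ℕ
  child rs j = value rs (answer rs j)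

  child↑ : ∀ rs → Increasing (child rs)
  child↑ rs j = legal-> (legal rs (child rs j))

  follow : List ℕ → List ℕ → List ℕ
  follow rs [] = rs
  follow rs (j ∷ ρ) = follow (rs ∷ʳ answer rs j) ρ

  follow-++ : ∀ rs ρ ρ′ → follow rs (ρ ++ ρ′) ≡ follow (follow rs ρ) ρ′
  follow-++ rs [] ρ′ = refl
  follow-++ rs (j ∷ ρ) ρ′ = follow-++ (rs ∷ʳ answer rs j) ρ ρ′

  σ-⊑-follow : ∀ rs ρ → σ rs ⊑ σ (follow rs ρ)
  σ-⊑-follow rs [] = ⊑-refl _
  σ-⊑-follow rs (j ∷ ρ) = ⊑-trans (legal-⊑ (legal rs (answer rs j))) (σ-⊑-follow (rs ∷ʳ answer rs j) ρ)

  child-⊑-follow : ∀ rs j ρ → (σ rs ∷ʳ child rs j) ⊑ σ (follow rs (j ∷ ρ))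
  child-⊑-follow rs j ρ = ⊑-trans (legal-∷ʳ-⊑ (legal rs (answer rs j))) (σ-⊑-follow (rs ∷ʳ answer rs j) ρ)

  σ-follow-split : ∀ rs ρ → Split p (σ rs) → Split p (σ (follow rs ρ))
  σ-follow-split rs [] split = split
  σ-follow-split rs (j ∷ ρ) _ = σ-follow-split (rs ∷ʳ answer rs j) ρ (legal-split (legal rs (answer rs j)))

  -- Two plays from rs agree up to σ rs and then part at distinct children, so a node with two
  -- distinct successors along them is a position.
  branching : ∀ rs ρ₁ ρ₂ {x a b} → (x ∷ʳ a) ⊑ σ (follow rs ρ₁) → (x ∷ʳ b) ⊑ σ (follow rs ρ₂) → a ≢ b
    → (∃[ ρ ] (x ≡ σ (follow rs ρ))) × S a × S b
  branching rs [] ρ₂ h₁ h₂ a≢b =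
    ⊥-elim (a≢b (⊑-∷ʳ-agree (⊑-refl _) (σ-⊑-follow rs ρ₂) (⊑-∷ʳ-length h₁) h₁ h₂))
  branching rs (j ∷ ρ₁) [] h₁ h₂ a≢b =
    ⊥-elim (a≢b (⊑-∷ʳ-agree (σ-⊑-follow rs (j ∷ ρ₁)) (⊑-refl _) (⊑-∷ʳ-length h₂) h₁ h₂))
  branching rs (j₁ ∷ ρ₁) (j₂ ∷ ρ₂) {x} {a} {b} h₁ h₂ a≢b with <-cmp (length x) (length (σ rs))
  ... | tri< x<σ _ _ =
    ⊥-elim (a≢b (⊑-∷ʳ-agree (σ-⊑-follow rs (j₁ ∷ ρ₁)) (σ-⊑-follow rs (j₂ ∷ ρ₂)) x<σ h₁ h₂))
  ... | tri≈ _ x≡σ _ = ([] , x≡σrs) , subst S (sym (valueAt j₁ ρ₁ h₁)) (legal-∈S (legal rs (answer rs j₁)))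
                                    , subst S (sym (valueAt j₂ ρ₂ h₂)) (legal-∈S (legal rs (answer rs j₂)))
    where
    x≡σrs : x ≡ σ rs
    x≡σrs = ⊑-unique-length (⊑-trans (⊑-++ x [ a ]) h₁) (σ-⊑-follow rs (j₁ ∷ ρ₁)) x≡σ
    valueAt : ∀ j ρ {c} → (x ∷ʳ c) ⊑ σ (follow rs (j ∷ ρ)) → c ≡ child rs j
    valueAt j ρ h = trans (sym (⊑-∷ʳ-! h))
      (trans (cong (σ (follow rs (j ∷ ρ)) !_) x≡σ) (⊑-∷ʳ-! (child-⊑-follow rs j ρ)))
  ... | tri> _ _ σ<x
    with increasing-injective (child↑ rs) {j₁} {j₂} (trans (entry j₁ ρ₁ h₁) (sym (entry j₂ ρ₂ h₂)))
    where
    entry : ∀ j ρ {c} → (x ∷ʳ c) ⊑ σ (follow rs (j ∷ ρ)) → child rs j ≡ x ! length (σ rs)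
    entry j ρ {c} h = trans (sym (⊑-∷ʳ-! (child-⊑-follow rs j ρ))) (sym (⊑-! (⊑-trans (⊑-++ x [ c ]) h) σ<x))
  ...   | refl with branching (rs ∷ʳ answer rs j₁) ρ₁ ρ₂ h₁ h₂ a≢b
  ...     | (ρ , x≡) , Sa , Sb = (j₁ ∷ ρ , x≡) , Sa , Sb

  IsNode : Seq → Set
  IsNode x = ∃[ ρ ] (x ≡ σ (follow [] ρ))

  tree : TreePred
  tree x = ∃[ ρ ] (x ⊑ σ (follow [] ρ))

  tree-branching : ∀ {x a b} → tree (x ∷ʳ a) → tree (x ∷ʳ b) → a ≢ b → IsNode x × S a × S b
  tree-branching (ρ₁ , h₁) (ρ₂ , h₂) = branching [] ρ₁ ρ₂ h₁ h₂

  node-split : ∀ {x} → IsNode x → Split tree x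
  node-split (ρ , refl) = (ρ , ⊑-refl _) , λ j →
    child rs j , increasing-≥ (child↑ rs) j , ρ ++ [ j ] ,
    subst (λ rs′ → (σ rs ∷ʳ child rs j) ⊑ σ rs′) (sym (follow-++ [] ρ [ j ])) (child-⊑-follow rs j [])
    where rs = follow [] ρ

  tree-splitSuccessor∈S : ∀ {x a} → Split tree x → tree (x ∷ʳ a) → S a
  tree-splitSuccessor∈S {a = a} (_ , succ) xa∈tree with succ (suc a)
  ... | k , a<k , xk∈tree = proj₁ (proj₂ (tree-branching xa∈tree xk∈tree (<⇒≢ a<k)))

  branch-meetsSplit : ∀ {f} → Branch tree f → ∀ N → ∃[ n ] (N ≤ n × Split tree (f ↾ n))
  branch-meetsSplit {f} br N with br N
  ... | ρ , f↾N⊑c with ↾-branchesOff f (σ (follow [] ρ))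
  ...   | inj₁ f↾c≡c =
    _ , subst (_≤ _) (length-↾ f N) (⊑-length f↾N⊑c) , subst (Split tree) (sym f↾c≡c) (node-split (ρ , refl))
  ...   | inj₂ (i , _ , fi≢ci , h) = i , N≤i , node-split (proj₁ (tree-branching fi∈tree (ρ , h) fi≢ci))
    where
    fi∈tree : tree ((f ↾ i) ∷ʳ f i)
    fi∈tree = subst tree (↾-suc f i) (br (suc i))
    N≤i : N ≤ i
    N≤i with i <? N
    ... | no i≮N = ≮⇒≥ i≮N
    ... | yes i<N = ⊥-elim (fi≢ci (trans (sym (↾-! f i<N)) (⊑-! f↾N⊑c (subst (i <_) (sym (length-↾ f N)) i<N))))

  module _ (Tp : IsTree p) (p↑ : ∀ s → p s → StrictlyIncreasing s) (split₀ : Split p (σ [])) where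

    tree-⊆ : ∀ x → tree x → p x
    tree-⊆ x (ρ , h) = IsTree-⊑ Tp h (proj₁ (σ-follow-split [] ρ split₀))

    tree-Miller : MillerTree tree
    tree-Miller = (([] , σ [] , refl) , λ s t (ρ , h) → ρ , ⊑-trans (⊑-++ s t) h)
                , (λ s s∈tree → p↑ s (tree-⊆ s s∈tree))
                , λ s (ρ , h) → σ (follow [] ρ) , h , node-split (ρ , refl)

    tree-splitBranchesIn : SplitBranchesIn tree S
    tree-splitBranchesIn X (f , br , X⊆Sp , Sp⊆X) = X⊆S , X-infinite
      where
      X⊆S : X ⊆ω S
      X⊆S m Xm with X⊆Sp m Xm
      ... | n , split , refl = tree-splitSuccessor∈S split (subst tree (↾-suc f n) (br (suc n)))
      X-infinite : Infinite X
      X-infinite N with branch-meetsSplit br N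
      ... | n , N≤n , split = f n , ≤-trans N≤n (increasingBranch-≥ (λ s → p↑ s ∘ tree-⊆ s) br n)
                            , Sp⊆X (f n) (n , split , refl)

IWins⇒splitSubtree : ∀ {p S} → MillerTree p → PlayerIWins p S → ∃[ q ] (q ≤M p × SplitBranchesIn q S)
IWins⇒splitSubtree {p} {S} (Tp , p↑ , _) (σ , split₀ , legal) =
  tree , (tree-Miller Tp p↑ split₀ , tree-⊆ Tp p↑ split₀) , tree-splitBranchesIn Tp p↑ split₀
  where open StrategyTree {p} {S} σ legal

-- Player II

BelowFrom : TreePred → SubsetOfω → (Seq → ℕ) → (ℕ → ℕ) → ℕ → Set
BelowFrom p S H f N = ∀ n → N ≤ n → Split p (f ↾ n) → S (f n) → f n < H (f ↾ n)

EventuallyBelow : TreePred → SubsetOfω → (Seq → ℕ) → (ℕ → ℕ) → Set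
EventuallyBelow p S H f = ∃[ N ] BelowFrom p S H f N

maxLength : List Seq → ℕ
maxLength L = max 0 (map length L)

⊆*⇒eventuallyBelow : ∀ {p S H f} → SplitInS p S f ⊆* SplitBelowH p H f → EventuallyBelow p S H f
⊆*⇒eventuallyBelow {p} {S} {H} {f} (L , cover) = suc (maxLength L) , below
  where
  below : BelowFrom p S H f (suc (maxLength L))
  below n L<n split Sfn with cover (f ↾ n) (n , refl , split , Sfn)
  ... | inj₁ (m , f↾n≡f↾m , _ , fm<H) = subst (λ k → f k < H (f ↾ n)) (↾-injectiveˡ f (sym f↾n≡f↾m)) fm<H
  ... | inj₂ f↾n∈L = ⊥-elim (<-irrefl refl (<-≤-trans L<n (begin
    n                  ≡⟨ sym (length-↾ f n) ⟩
    length (f ↾ n)     ≤⟨ All.lookup (xs≤max 0 (map length L)) (∈-map⁺ length f↾n∈L) ⟩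
    maxLength L        ∎)))
    where open ≤-Reasoning

eventuallyBelow⇒⊆* : ∀ {p S H f} → EventuallyBelow p S H f → SplitInS p S f ⊆* SplitBelowH p H f
eventuallyBelow⇒⊆* {p} {S} {H} {f} (N , below) = applyUpTo (f ↾_) N , cover
  where
  cover : ∀ s → SplitInS p S f s → SplitBelowH p H f s ⊎ s ∈ applyUpTo (f ↾_) N
  cover _ (n , refl , split , Sfn) with n <? N
  ... | yes n<N = inj₂ (∈-applyUpTo⁺ (f ↾_) n<N)
  ... | no n≮N = inj₁ (n , refl , split , below n (≮⇒≥ n≮N) split Sfn)

last-∷ʳ : ∀ {A : Set} (xs : List A) x → last (xs ∷ʳ x) ≡ just x
last-∷ʳ [] x = refl
last-∷ʳ (y ∷ []) x = refl
last-∷ʳ (y ∷ z ∷ xs) x = last-∷ʳ (z ∷ xs) x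

eventuallyBelow⇒IIWins : ∀ {p S} → IsTree p → ∃[ H ] (∀ f → Branch p f → EventuallyBelow p S H f)
  → PlayerIIWins p S
eventuallyBelow⇒IIWins {p} {S} Tp (H , eventually) = τ , defeated
  where
  τ : List Seq → ℕ
  τ = maybe′ H 0 ∘ last

  τ-play : ∀ (ss : ℕ → Seq) i → τ (map ss (upTo (suc i))) ≡ H (ss i)
  τ-play ss i = trans (cong (maybe′ H 0 ∘ last) (trans (map-upTo ss (suc i)) (sym (applyUpTo-∷ʳ ss i))))
                      (cong (maybe′ H 0) (last-∷ʳ (applyUpTo ss i) (ss i)))

  defeated : WinningStrategyII p S τ
  defeated (ss , split₀ , legal) = <-asym H<k k<H
    where
    open LegalMoves p S
    grows : Increasing (length ∘ ss)
    grows i = legal-grows (legal i)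
    open Limit ss (λ i → legal-⊑ (legal i)) grows
    split : ∀ i → Split p (ss i)
    split zero = split₀
    split (suc i) = legal-split (legal i)
    N = proj₁ (eventually lim (lim-branch Tp (proj₁ ∘ split)))
    below = proj₂ (eventually lim (lim-branch Tp (proj₁ ∘ split)))
    n = length (ss N)
    k = legal-value (legal N)
    lim-n≡k : lim n ≡ k
    lim-n≡k = trans (lim-! (suc N) (legal-grows (legal N))) (⊑-∷ʳ-! (legal-∷ʳ-⊑ (legal N)))
    H<k : H (ss N) < k
    H<k = subst (_< k) (τ-play ss N) (legal-> (legal N))
    k<H : k < H (ss N)
    k<H = subst₂ _<_ lim-n≡k (cong H (lim-↾ N))
            (below n (increasing-≥ grows N) (subst (Split p) (sym (lim-↾ N)) (split N))
                   (subst S (sym lim-n≡k) (legal-∈S (legal N))))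

decide : ExcludedMiddle (lsuc 0ℓ) → (P : Set) → Dec P
decide lem P = map′ lower lift lem

Violation : TreePred → SubsetOfω → (Seq → ℕ) → (ℕ → ℕ) → ℕ → Set
Violation p S H f n = Split p (f ↾ n) × S (f n) × H (f ↾ n) ≤ f n

violatedInfinitelyOften : ExcludedMiddle (lsuc 0ℓ) → ∀ {p S H f}
  → ¬ EventuallyBelow p S H f → Infinite (Violation p S H f)
violatedInfinitelyOften lem {p} {S} {H} {f} ¬below N with decide lem (∃[ n ] (N ≤ n × Violation p S H f n))
... | yes violation = violation
... | no ¬violation =
  ⊥-elim (¬below (N , λ n N≤n split Sfn → ≰⇒> (λ H≤fn → ¬violation (n , N≤n , split , Sfn , H≤fn))))

IIWins⇒eventuallyBelow : ExcludedMiddle (lsuc 0ℓ) → ∀ {p S} → PlayerIIWins p S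
  → ∃[ H ] (∀ f → EventuallyBelow p S H f)
IIWins⇒eventuallyBelow lem {p} {S} (τ , wins) = H , eventuallyBelow
  where
  H : Seq → ℕ
  H s = suc (boundOn (inits s) τ (suc (length s)))

  eventuallyBelow : ∀ f → EventuallyBelow p S H f
  eventuallyBelow f with decide lem (EventuallyBelow p S H f)
  ... | yes below = below
  ... | no ¬below = ⊥-elim (wins (position , proj₁ (nth-P 0) , legal))
    where
    open Enumeration (violatedInfinitelyOften lem {p} {S} {H} {f} ¬below)

    position : ℕ → Seq
    position i = f ↾ nth i

    answer<H : ∀ i → τ (map position (upTo (suc i))) < H (position i)
    answer<H i = s≤s (≤-boundOn (inits (position i)) τ earlier∈inits length≤)
      where
      earlier∈inits : All (_∈ inits (position i)) (map position (upTo (suc i)))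
      earlier∈inits = subst (All (_∈ inits (position i))) (sym (map-upTo position (suc i)))
        (applyUpTo⁺₁ position (suc i) (λ j<1+i → ⊑⇒∈inits (↾-mono f (increasing-mono nth↑ (≤-pred j<1+i)))))
      length≤ : length (map position (upTo (suc i))) ≤ suc (length (position i))
      length≤ = begin
        length (map position (upTo (suc i)))  ≡⟨ length-map position (upTo (suc i)) ⟩
        length (upTo (suc i))                 ≡⟨ length-upTo (suc i) ⟩
        suc i                                 ≤⟨ s≤s (increasing-≥ nth↑ i) ⟩
        suc (nth i)                           ≡⟨ cong suc (sym (length-↾ f (nth i))) ⟩
        suc (length (position i))             ∎
        where open ≤-Reasoning

    legal : ∀ i → LegalNext p S (position i) (τ (map position (upTo (suc i)))) (position (suc i))
    legal i =
      let (_ , Sfn , H≤fn) = nth-P i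
          (u , eq) = ↾-step f (nth↑ i)
      in proj₁ (nth-P (suc i)) , f (nth i) , u , eq , Sfn , <-≤-trans (answer<H i) H≤fn

eventuallyBelow⇒K : ∀ {p S H} → (∀ f → Branch p f → EventuallyBelow p S H f) → InK p (SplitHit p S)
eventuallyBelow⇒K {p} {S} {H} eventually = (λ _ → proj₁) , H , caught
  where
  caught : ∀ X → SplitHit p S X → Catch∃ p H X
  caught X ((f , br , X≐Sp) , hits) = f , br , X≐Sp , belowInfinitelyOften
    where
    belowInfinitelyOften : Infinite (λ n → Split p (f ↾ n) × f n < H (f ↾ n))
    belowInfinitelyOften k with eventually f br
    ... | N , below with hits (suc (maxUpTo f (k + N)))
    ...   | m , large , Xm , Sm with proj₁ X≐Sp m Xm
    ...     | n , split , refl = n , ≤-trans (m≤m+n k N) (<⇒≤ k+N<n) , split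
                               , below n (≤-trans (m≤n+m N k) (<⇒≤ k+N<n)) split Sm
      where
      k+N<n : k + N < n
      k+N<n with n ≤? k + N
      ... | yes n≤k+N = ⊥-elim (<-irrefl refl (<-≤-trans (s≤s (≤-maxUpTo f n≤k+N)) large))
      ... | no n≰k+N = ≰⇒> n≰k+N

lemma17 : ExcludedMiddle (lsuc 0ℓ) → (p : TreePred) → (S : SubsetOfω)
    → MillerTree p → Infinite S
    → (PlayerIWins p S ⇔ (∃[ q ] (q ≤M p × SplitBranchesIn q S)))
      × (PlayerIIWins p S ⇔ (∃[ H ] (∀ f → Branch p f → SplitInS p S f ⊆* SplitBelowH p H f)))
      × (PlayerIIWins p S → InK p (SplitHit p S))
lemma17 lem p S Mp _ =
    mk⇔ (IWins⇒splitSubtree Mp) splitSubtree⇒IWins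
  , mk⇔ IIWins⇒almostBelow almostBelow⇒IIWins
  , λ IIwins → let (H , below) = IIWins⇒eventuallyBelow lem {p} {S} IIwins
               in eventuallyBelow⇒K {p} {S} {H} (λ f _ → below f)
  where
  IIWins⇒almostBelow : PlayerIIWins p S → ∃[ H ] (∀ f → Branch p f → SplitInS p S f ⊆* SplitBelowH p H f)
  IIWins⇒almostBelow IIwins =
    let (H , below) = IIWins⇒eventuallyBelow lem {p} {S} IIwins in H , λ f _ → eventuallyBelow⇒⊆* {p} {S} {H} (below f)

  almostBelow⇒IIWins : ∃[ H ] (∀ f → Branch p f → SplitInS p S f ⊆* SplitBelowH p H f) → PlayerIIWins p S
  almostBelow⇒IIWins (H , almost) = eventuallyBelow⇒IIWins {p} {S} (proj₁ Mp)
    (H , λ f br → ⊆*⇒eventuallyBelow {p} {S} {H} (almost f br))
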